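{- Let $\delta,k$ be integers with $0<\delta\le k-3$, let $V$ be a set with $|V|=n=2k+\delta$, and let $\mathcal K\subseteq 2^V$ be a $(k+\delta-1)$-uniform hypergraph satisfying (K1) $|K\cap K'|\ge\delta$ for all $K,K'\in\mathcal K$; (K2) $|K\cap K'|\le k-2$ for all distinct $K,K'\in\mathcal K$; (K3) no singleton is a transversal of $\mathcal K$ (i.e., for every $v\in V$ some $K\in\mathcal K$ avoids $v$). Let $\mathcal H=\{H\subseteq V: |H|=k,\ H\not\subseteq K \text{ for all } K\in\mathcal K\}$. Then $\mathcal H$ is minimal transversal-free.
   Context: A hypergraph $\mathcal H$ on ground set $V$ is transversal-free if for every $H\in\mathcal H$ there is $H'\in\mathcal H$ with $H\cap H'=\emptyset$. For $S\subseteq V$, $\mathcal H_S=\{H\in\mathcal H:H\subseteq S\}$. $\mathcal H$ is minimal transversal-free if it is transversal-free and for every $S\subsetneq V$ with $\mathcal H_S\neq\emptyset$, $\mathcal H_S$ contains a hyperedge meeting all hyperedges of $\mathcal H_S$. -}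

module Defs where

open import Data.Nat using (ℕ; _+_; _∸_; _*_)
open import Data.Fin using (Fin)
open import Data.Fin.Subset using (Subset; _⊆_; _⊂_; _∩_; ∣_∣; Empty; Nonempty; ⊤; _∉_)
open import Data.List using (List)
open import Data.List.Membership.Propositional using () renaming (_∈_ to _∈ₗ_)
open import Data.Product using (_×_; ∃-syntax; Σ-syntax)
open import Relation.Binary.PropositionalEquality using (_≡_; _≢_)
open import Relation.Nullary using (¬_)

Hypergraph : ℕ → Set₁
Hypergraph n = Subset n → Set

restrict : ∀ {n} → Hypergraph n → Subset n → Hypergraph n
restrict 𝓗 S H = 𝓗 H × H ⊆ S

TransversalFree : ∀ {n} → Hypergraph n → Set
TransversalFree 𝓗 = ∀ H → 𝓗 H → ∃[ H' ] (𝓗 H' × Empty (H ∩ H'))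

MinimalTransversalFree : ∀ {n} → Hypergraph n → Set
MinimalTransversalFree {n} 𝓗 =
  TransversalFree 𝓗 ×
  (∀ (S : Subset n) → S ⊂ ⊤ → (∃[ H ] restrict 𝓗 S H) →
     ∃[ H ] (restrict 𝓗 S H × (∀ H' → restrict 𝓗 S H' → Nonempty (H ∩ H'))))

kSetsNotInAny : ∀ {n} → ℕ → List (Subset n) → Hypergraph n
kSetsNotInAny k 𝒦 H = ∣ H ∣ ≡ k × (∀ K → K ∈ₗ 𝒦 → ¬ (H ⊆ K))

Uniform : ∀ {n} → ℕ → List (Subset n) → Set
Uniform r 𝒦 = ∀ K → K ∈ₗ 𝒦 → ∣ K ∣ ≡ r

K1 : ∀ {n} → ℕ → List (Subset n) → Set
K1 δ 𝒦 = ∀ K K' → K ∈ₗ 𝒦 → K' ∈ₗ 𝒦 → δ Data.Nat.≤ ∣ K ∩ K' ∣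

K2 : ∀ {n} → ℕ → List (Subset n) → Set
K2 k 𝒦 = ∀ K K' → K ∈ₗ 𝒦 → K' ∈ₗ 𝒦 → K ≢ K' → ∣ K ∩ K' ∣ Data.Nat.≤ k ∸ 2

K3 : ∀ {n} → List (Subset n) → Set
K3 {n} 𝒦 = ∀ (v : Fin n) → ∃[ K ] (K ∈ₗ 𝒦 × v ∉ K)

module Submission where

-- The proof
-- rests on one exchange argument.  Call a set uncovered if it lies in no
-- member of 𝒦.  Exchange lemma: if T is a k-set inside an uncovered set C
-- and x ∈ T, then some H ∈ 𝓗 satisfies T - x ⊆ H ⊆ C.  Indeed, either T is
-- uncovered (take H = T), or T ⊆ K₁ ∈ 𝒦; then pick y ∈ C ─ K₁ and put
-- H = (T - x) ∪ {y}; if H ⊆ K₂ ∈ 𝒦, then K₂ ≠ K₁ and the (k-1)-set T - x lies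
-- in K₁ ∩ K₂, contradicting (K2).
--   Transversal-freeness: the complement of H ∈ 𝓗 has k + δ elements, more
-- than any member of 𝒦, so it is uncovered; exchange inside any k-subset.
--   Minimality: for S ⊊ V pick v ∉ S and (K3) a K ∈ 𝒦 avoiding v.  Every
-- H' ∈ 𝓗_S leaves K, hence meets D = S ─ K, so any H ∈ 𝓗_S containing D meets
-- all of 𝓗_S.  As D ⊊ ∁ K we have |D| ≤ k; extend D to a k-set H₁ ⊆ S.  If
-- H₁ misses K, then (K1) and the uniformity show H₁ ∈ 𝓗; otherwise exchange
-- an x ∈ H₁ ∩ K inside S (which is uncovered as it contains a hyperedge).

open import Defs
open import Data.Nat using (ℕ; zero; suc; _+_; _∸_; _*_; _≤_; _<_; z≤n; s≤s; s≤s⁻¹)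
open import Data.Nat.Properties
open import Data.Nat.Tactic.RingSolver using (solve-∀)
open import Data.Fin using (Fin)
open import Data.Fin.Properties using (¬∀⟶∃¬)
open import Data.Fin.Subset
open import Data.Fin.Subset.Properties
open import Data.List using (List)
open import Data.List.Membership.Propositional using (find; lose) renaming (_∈_ to _∈ₗ_)
open import Data.List.Relation.Unary.Any using (any?)
open import Data.Vec using ([]; _∷_; here; there)
open import Data.Product using (_×_; _,_; ∃; ∃-syntax)
open import Data.Sum using (_⊎_; inj₁; inj₂)
open import Function using (_∘_)
open import Relation.Nullary using (¬_; yes; no; contradiction)
open import Relation.Nullary.Decidable using (_→-dec_)
open import Relation.Binary.PropositionalEquality
  using (_≡_; _≢_; refl; sym; trans; cong; cong₂; subst; module ≡-Reasoning)

private
  variable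
    n k r δ : ℕ
    p q C D H K S T : Subset n
    x y : Fin n
    𝒦 : List (Subset n)

⊈⇒witness : ¬ (p ⊆ q) → ∃ λ x → x ∈ p × x ∉ q
⊈⇒witness {n} {p} {q} p⊈q
  with ¬∀⟶∃¬ n _ (λ x → x ∈? p →-dec x ∈? q) (λ p⊆q → p⊈q (p⊆q _))
... | x , ¬[x∈p⇒x∈q] with x ∈? p
...   | yes x∈p = x , x∈p , λ x∈q → ¬[x∈p⇒x∈q] (λ _ → x∈q)
...   | no  x∉p = contradiction (λ x∈p → contradiction x∈p x∉p) ¬[x∈p⇒x∈q]

x∈p─q⇒x∉q : x ∈ p ─ q → x ∉ q
x∈p─q⇒x∉q {x = Fin.zero} {p = _ ∷ _} {q = inside  ∷ _} ()
x∈p─q⇒x∉q {x = Fin.zero} {p = _ ∷ _} {q = outside ∷ _} _ ()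
x∈p─q⇒x∉q {p = _ ∷ _} {q = _ ∷ _} (there x∈p─q) (there x∈q) = x∈p─q⇒x∉q x∈p─q x∈q

∪-⊆ : p ⊆ C → q ⊆ C → p ∪ q ⊆ C
∪-⊆ {p = p} {q = q} p⊆C q⊆C x∈p∪q with x∈p∪q⁻ p q x∈p∪q
... | inj₁ x∈p = p⊆C x∈p
... | inj₂ x∈q = q⊆C x∈q

size>0⇒nonempty : (p : Subset n) → 0 < ∣ p ∣ → Nonempty p
size>0⇒nonempty (inside  ∷ p) _ = Fin.zero , here
size>0⇒nonempty (outside ∷ p) ∣p∣>0 with size>0⇒nonempty p ∣p∣>0
... | x , x∈p = Fin.suc x , there x∈p

choose : (p : Subset n) (m : ℕ) → m ≤ ∣ p ∣ → ∃ λ q → q ⊆ p × ∣ q ∣ ≡ m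
choose {n} p zero _ = ⊥ , ⊥⊆ , ∣⊥∣≡0 n
choose (outside ∷ p) (suc m) m<∣p∣ with choose p (suc m) m<∣p∣
... | q , q⊆p , ∣q∣≡m = outside ∷ q , out⊆ q⊆p , ∣q∣≡m
choose (inside  ∷ p) (suc m) (s≤s m≤∣p∣) with choose p m m≤∣p∣
... | q , q⊆p , ∣q∣≡m = inside ∷ q , s⊆s q⊆p , cong suc ∣q∣≡m

∣p∣≡∣p∩q∣+∣p─q∣ : (p q : Subset n) → ∣ p ∣ ≡ ∣ p ∩ q ∣ + ∣ p ─ q ∣
∣p∣≡∣p∩q∣+∣p─q∣ []            []            = refl
∣p∣≡∣p∩q∣+∣p─q∣ (outside ∷ p) (inside  ∷ q) = ∣p∣≡∣p∩q∣+∣p─q∣ p q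
∣p∣≡∣p∩q∣+∣p─q∣ (outside ∷ p) (outside ∷ q) = ∣p∣≡∣p∩q∣+∣p─q∣ p q
∣p∣≡∣p∩q∣+∣p─q∣ (inside  ∷ p) (inside  ∷ q) = cong suc (∣p∣≡∣p∩q∣+∣p─q∣ p q)
∣p∣≡∣p∩q∣+∣p─q∣ (inside  ∷ p) (outside ∷ q) =
  trans (cong suc (∣p∣≡∣p∩q∣+∣p─q∣ p q)) (sym (+-suc _ _))

∣p∪q∣≡∣p∣+∣q∣ : (p q : Subset n) → (∀ {x} → x ∈ p → x ∉ q) → ∣ p ∪ q ∣ ≡ ∣ p ∣ + ∣ q ∣
∣p∪q∣≡∣p∣+∣q∣ [] [] _ = refl
∣p∪q∣≡∣p∣+∣q∣ (inside  ∷ p) (inside  ∷ q) disj = contradiction here (disj here)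
∣p∪q∣≡∣p∣+∣q∣ (inside  ∷ p) (outside ∷ q) disj =
  cong suc (∣p∪q∣≡∣p∣+∣q∣ p q (λ x∈p x∈q → disj (there x∈p) (there x∈q)))
∣p∪q∣≡∣p∣+∣q∣ (outside ∷ p) (inside  ∷ q) disj =
  trans (cong suc (∣p∪q∣≡∣p∣+∣q∣ p q (λ x∈p x∈q → disj (there x∈p) (there x∈q))))
        (sym (+-suc _ _))
∣p∪q∣≡∣p∣+∣q∣ (outside ∷ p) (outside ∷ q) disj =
  ∣p∪q∣≡∣p∣+∣q∣ p q (λ x∈p x∈q → disj (there x∈p) (there x∈q))

∣p-x∣+1≡∣p∣ : x ∈ p → suc ∣ p - x ∣ ≡ ∣ p ∣
∣p-x∣+1≡∣p∣ {p = inside  ∷ p} here          = cong (suc ∘ ∣_∣) (p─⊥≡p p)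
∣p-x∣+1≡∣p∣ {p = inside  ∷ p} (there x∈p) = cong suc (∣p-x∣+1≡∣p∣ x∈p)
∣p-x∣+1≡∣p∣ {p = outside ∷ p} (there x∈p) = ∣p-x∣+1≡∣p∣ x∈p

exchange : Subset n → Fin n → Fin n → Subset n
exchange T x y = (T - x) ∪ ⁅ y ⁆

exchange-size : x ∈ T → y ∉ T → ∣ exchange T x y ∣ ≡ ∣ T ∣
exchange-size {x = x} {T = T} {y = y} x∈T y∉T = begin
  ∣ (T - x) ∪ ⁅ y ⁆ ∣   ≡⟨ ∣p∪q∣≡∣p∣+∣q∣ (T - x) ⁅ y ⁆ y∉T-x ⟩
  ∣ T - x ∣ + ∣ ⁅ y ⁆ ∣ ≡⟨ cong (∣ T - x ∣ +_) (∣⁅x⁆∣≡1 y) ⟩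
  ∣ T - x ∣ + 1         ≡⟨ +-comm _ 1 ⟩
  suc ∣ T - x ∣         ≡⟨ ∣p-x∣+1≡∣p∣ x∈T ⟩
  ∣ T ∣                 ∎
  where
  open ≡-Reasoning
  y∉T-x : ∀ {z} → z ∈ T - x → z ∉ ⁅ y ⁆
  y∉T-x z∈T-x z∈⁅y⁆ =
    y∉T (subst (_∈ T) (x∈⁅y⁆⇒x≡y y z∈⁅y⁆) (p─q⊆p T ⁅ x ⁆ z∈T-x))

exchange-⊆ : T ⊆ C → y ∈ C → exchange T x y ⊆ C
exchange-⊆ {T = T} {C = C} {y = y} {x = x} T⊆C y∈C =
  ∪-⊆ (T⊆C ∘ p─q⊆p T ⁅ x ⁆) (λ z∈⁅y⁆ → subst (_∈ C) (sym (x∈⁅y⁆⇒x≡y y z∈⁅y⁆)) y∈C)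

q⊆∁p⇒disjoint : q ⊆ ∁ p → Empty (p ∩ q)
q⊆∁p⇒disjoint {q = q} {p = p} q⊆∁p (z , z∈p∩q) with x∈p∩q⁻ p q z∈p∩q
... | z∈p , z∈q = x∈∁p⇒x∉p (q⊆∁p z∈q) z∈p

Uncovered : List (Subset n) → Subset n → Set
Uncovered 𝒦 T = ∀ K → K ∈ₗ 𝒦 → ¬ (T ⊆ K)

covered-or-uncovered : (𝒦 : List (Subset n)) (T : Subset n) →
  (∃[ K ] (K ∈ₗ 𝒦 × T ⊆ K)) ⊎ Uncovered 𝒦 T
covered-or-uncovered 𝒦 T with any? (T ⊆?_) 𝒦
... | yes covered = inj₁ (find covered)
... | no  ¬covered = inj₂ (λ K K∈𝒦 T⊆K → ¬covered (lose K∈𝒦 T⊆K))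

uncovered-⊆ : Uncovered 𝒦 T → T ⊆ C → Uncovered 𝒦 C
uncovered-⊆ T-unc T⊆C K K∈𝒦 C⊆K = T-unc K K∈𝒦 (⊆-trans T⊆C C⊆K)

large⇒uncovered : Uniform r 𝒦 → r < ∣ C ∣ → Uncovered 𝒦 C
large⇒uncovered unif r<∣C∣ K K∈𝒦 C⊆K =
  <⇒≱ r<∣C∣ (≤-trans (p⊆q⇒∣p∣≤∣q∣ C⊆K) (≤-reflexive (unif K K∈𝒦)))

-- Under (K1), a k-set missing a member K of 𝒦 is uncovered provided the
-- uniform size r is below k + δ: a member containing it would contain it
-- together with at least δ further elements of K.
disjoint⇒uncovered : Uniform r 𝒦 → K1 δ 𝒦 → r < k + δ → K ∈ₗ 𝒦 →
  Empty (H ∩ K) → ∣ H ∣ ≡ k → Uncovered 𝒦 H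
disjoint⇒uncovered {r = r} {δ = δ} {k = k} {K = K} {H = H}
                   unif k1 r<k+δ K∈𝒦 H∩K=∅ ∣H∣≡k K₁ K₁∈𝒦 H⊆K₁ =
  <⇒≱ r<k+δ (begin
    k + δ                       ≤⟨ +-mono-≤ k≤∣K₁∩H∣ δ≤∣K₁─H∣ ⟩
    ∣ K₁ ∩ H ∣ + ∣ K₁ ─ H ∣       ≡⟨ ∣p∣≡∣p∩q∣+∣p─q∣ K₁ H ⟨
    ∣ K₁ ∣                       ≡⟨ unif K₁ K₁∈𝒦 ⟩
    r                           ∎)
  where
  open ≤-Reasoning
  k≤∣K₁∩H∣ : k ≤ ∣ K₁ ∩ H ∣
  k≤∣K₁∩H∣ = subst (_≤ ∣ K₁ ∩ H ∣) ∣H∣≡k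
    (p⊆q⇒∣p∣≤∣q∣ (λ z∈H → x∈p∩q⁺ (H⊆K₁ z∈H , z∈H)))
  K∩K₁⊆K₁─H : K ∩ K₁ ⊆ K₁ ─ H
  K∩K₁⊆K₁─H z∈K∩K₁ with x∈p∩q⁻ K K₁ z∈K∩K₁
  ... | z∈K , z∈K₁ = x∈p∧x∉q⇒x∈p─q z∈K₁ (λ z∈H → H∩K=∅ (_ , x∈p∩q⁺ (z∈H , z∈K)))
  δ≤∣K₁─H∣ : δ ≤ ∣ K₁ ─ H ∣
  δ≤∣K₁─H∣ = ≤-trans (k1 K K₁ K∈𝒦 K₁∈𝒦) (p⊆q⇒∣p∣≤∣q∣ K∩K₁⊆K₁─H)

-- Under (K2), a k-set covered by K₁ stays uncovered after exchanging one of
-- its elements for some y ∉ K₁: a member K₂ covering the result differs from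
-- K₁ and shares the k - 1 remaining elements with it.
exchange-uncovered : 2 ≤ k → K2 k 𝒦 → ∣ T ∣ ≡ k → K ∈ₗ 𝒦 → T ⊆ K → x ∈ T → y ∉ K →
  Uncovered 𝒦 (exchange T x y)
exchange-uncovered {k = k} {T = T} {K = K₁} {x = x} {y = y}
                   2≤k k2 ∣T∣≡k K₁∈𝒦 T⊆K₁ x∈T y∉K₁ K₂ K₂∈𝒦 T'⊆K₂ =
  <⇒≱ (suc[k∸2]<k 2≤k) (begin
    k               ≡⟨ ∣T∣≡k ⟨
    ∣ T ∣           ≡⟨ ∣p-x∣+1≡∣p∣ x∈T ⟨
    suc ∣ T - x ∣   ≤⟨ s≤s (≤-trans (p⊆q⇒∣p∣≤∣q∣ T-x⊆K₁∩K₂) (k2 K₁ K₂ K₁∈𝒦 K₂∈𝒦 K₁≢K₂)) ⟩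
    suc (k ∸ 2)     ∎)
  where
  open ≤-Reasoning
  suc[k∸2]<k : ∀ {k} → 2 ≤ k → suc (k ∸ 2) < k
  suc[k∸2]<k {suc (suc k)} (s≤s (s≤s z≤n)) = n<1+n (suc k)
  K₁≢K₂ : K₁ ≢ K₂
  K₁≢K₂ refl = y∉K₁ (T'⊆K₂ (q⊆p∪q (T - x) ⁅ y ⁆ (x∈⁅x⁆ y)))
  T-x⊆K₁∩K₂ : T - x ⊆ K₁ ∩ K₂
  T-x⊆K₁∩K₂ z∈T-x = x∈p∩q⁺ (T⊆K₁ (p─q⊆p T ⁅ x ⁆ z∈T-x) , T'⊆K₂ (p⊆p∪q ⁅ y ⁆ z∈T-x))

exchange-lemma : 2 ≤ k → K2 k 𝒦 → T ⊆ C → ∣ T ∣ ≡ k → Uncovered 𝒦 C → x ∈ T →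
  ∃[ H ] (kSetsNotInAny k 𝒦 H × H ⊆ C × T - x ⊆ H)
exchange-lemma {𝒦 = 𝒦} {T = T} {x = x} 2≤k k2 T⊆C ∣T∣≡k C-unc x∈T
  with covered-or-uncovered 𝒦 T
... | inj₂ T-unc = T , (∣T∣≡k , T-unc) , T⊆C , p─q⊆p T ⁅ x ⁆
... | inj₁ (K₁ , K₁∈𝒦 , T⊆K₁) with ⊈⇒witness (C-unc K₁ K₁∈𝒦)
...   | y , y∈C , y∉K₁ =
  exchange T x y ,
  (trans (exchange-size x∈T (y∉K₁ ∘ T⊆K₁)) ∣T∣≡k ,
   exchange-uncovered 2≤k k2 ∣T∣≡k K₁∈𝒦 T⊆K₁ x∈T y∉K₁) ,
  exchange-⊆ T⊆C y∈C ,
  p⊆p∪q ⁅ y ⁆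

-- If complements of k-sets have at least k and more than r elements, then
-- each hyperedge H ∈ 𝓗 has a disjoint hyperedge: exchange inside ∁ H.
transversal-free : 2 ≤ k → k ≤ n ∸ k → r < n ∸ k → Uniform r 𝒦 → K2 k 𝒦 →
  TransversalFree (kSetsNotInAny {n} k 𝒦)
transversal-free {k = k} {n = n} {r = r} {𝒦 = 𝒦} 2≤k k≤n∸k r<n∸k unif k2 H (∣H∣≡k , _) =
  disjoint-edge (choose (∁ H) k (subst (k ≤_) (sym ∣∁H∣≡n∸k) k≤n∸k))
  where
  ∣∁H∣≡n∸k : ∣ ∁ H ∣ ≡ n ∸ k
  ∣∁H∣≡n∸k = trans (∣∁p∣≡n∸∣p∣ H) (cong (n ∸_) ∣H∣≡k)
  ∁H-unc : Uncovered 𝒦 (∁ H)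
  ∁H-unc = large⇒uncovered unif (subst (r <_) (sym ∣∁H∣≡n∸k) r<n∸k)
  disjoint-edge : (∃ λ T → T ⊆ ∁ H × ∣ T ∣ ≡ k) → ∃[ H' ] (kSetsNotInAny k 𝒦 H' × Empty (H ∩ H'))
  disjoint-edge (T , T⊆∁H , ∣T∣≡k) =
    let x , x∈T = size>0⇒nonempty T (subst (0 <_) (sym ∣T∣≡k) (≤-trans (s≤s z≤n) 2≤k))
        H' , H'∈𝓗 , H'⊆∁H , _ = exchange-lemma 2≤k k2 T⊆∁H ∣T∣≡k ∁H-unc x∈T
    in H' , H'∈𝓗 , q⊆∁p⇒disjoint H'⊆∁H

MeetsRestriction : Hypergraph n → Subset n → Subset n → Set
MeetsRestriction 𝓗 S H = restrict 𝓗 S H × (∀ H' → restrict 𝓗 S H' → Nonempty (H ∩ H'))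

-- Every H' ∈ 𝓗_S leaves K ∈ 𝒦, hence meets S ─ K; so a hyperedge of 𝓗_S
-- containing S ─ K meets all of 𝓗_S.
meets-restriction : K ∈ₗ 𝒦 → kSetsNotInAny k 𝒦 H → H ⊆ S → S ─ K ⊆ H →
  MeetsRestriction (kSetsNotInAny k 𝒦) S H
meets-restriction {K = K} {H = H} K∈𝒦 H∈𝓗 H⊆S S─K⊆H =
  (H∈𝓗 , H⊆S) , meets
  where
  meets : ∀ H' → restrict (kSetsNotInAny _ _) _ H' → Nonempty (H ∩ H')
  meets H' ((_ , H'-unc) , H'⊆S) with ⊈⇒witness (H'-unc K K∈𝒦)
  ... | z , z∈H' , z∉K = z , x∈p∩q⁺ (S─K⊆H (x∈p∧x∉q⇒x∈p─q (H'⊆S z∈H') z∉K) , z∈H')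

∣S─K∣<∣∁K∣ : ∀ {n r} {𝒦 : List (Subset n)} {K S : Subset n} →
  Uniform r 𝒦 → K ∈ₗ 𝒦 → (v : Fin n) → v ∉ S → v ∉ K → suc ∣ S ─ K ∣ ≤ n ∸ r
∣S─K∣<∣∁K∣ {n = n} {r = r} {K = K} {S = S} unif K∈𝒦 v v∉S v∉K = begin
  suc ∣ S ─ K ∣ ≤⟨ p⊂q⇒∣p∣<∣q∣ S─K⊂∁K ⟩
  ∣ ∁ K ∣       ≡⟨ ∣∁p∣≡n∸∣p∣ K ⟩
  n ∸ ∣ K ∣     ≡⟨ cong (n ∸_) (unif K K∈𝒦) ⟩
  n ∸ r         ∎
  where
  open ≤-Reasoning
  S─K⊂∁K : S ─ K ⊂ ∁ K
  S─K⊂∁K = (x∉p⇒x∈∁p ∘ x∈p─q⇒x∉q) , v , x∉p⇒x∈∁p v∉K , v∉S ∘ p─q⊆p S K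

extend : D ⊆ S → ∣ D ∣ ≤ k → k ≤ ∣ S ∣ → ∃[ H ] (D ⊆ H × H ⊆ S × ∣ H ∣ ≡ k)
extend {D = D} {S = S} {k = k} D⊆S ∣D∣≤k k≤∣S∣ =
  extension (choose (S ─ D) (k ∸ ∣ D ∣) (m≤n+o⇒m∸n≤o k ∣ D ∣ k≤∣D∣+∣S─D∣))
  where
  k≤∣D∣+∣S─D∣ : k ≤ ∣ D ∣ + ∣ S ─ D ∣
  k≤∣D∣+∣S─D∣ = begin
    k                      ≤⟨ k≤∣S∣ ⟩
    ∣ S ∣                  ≡⟨ ∣p∣≡∣p∩q∣+∣p─q∣ S D ⟩
    ∣ S ∩ D ∣ + ∣ S ─ D ∣  ≤⟨ +-monoˡ-≤ ∣ S ─ D ∣ (∣p∩q∣≤∣q∣ S D) ⟩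
    ∣ D ∣ + ∣ S ─ D ∣      ∎
    where open ≤-Reasoning
  extension : (∃ λ M → M ⊆ S ─ D × ∣ M ∣ ≡ k ∸ ∣ D ∣) → ∃[ H ] (D ⊆ H × H ⊆ S × ∣ H ∣ ≡ k)
  extension (M , M⊆S─D , ∣M∣≡k∸∣D∣) =
    D ∪ M , p⊆p∪q M , ∪-⊆ D⊆S (p─q⊆p S D ∘ M⊆S─D) , (begin
      ∣ D ∪ M ∣           ≡⟨ ∣p∪q∣≡∣p∣+∣q∣ D M (λ z∈D z∈M → x∈p─q⇒x∉q (M⊆S─D z∈M) z∈D) ⟩
      ∣ D ∣ + ∣ M ∣       ≡⟨ cong (∣ D ∣ +_) ∣M∣≡k∸∣D∣ ⟩
      ∣ D ∣ + (k ∸ ∣ D ∣) ≡⟨ m+[n∸m]≡n ∣D∣≤k ⟩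
      k                   ∎)
    where open ≡-Reasoning

-- Minimality for general parameters: with K avoiding v ∉ S, extend S ─ K to
-- a k-set H₁ ⊆ S; if H₁ misses K it is a hyperedge, otherwise exchange an
-- element of H₁ ∩ K inside S, which keeps S ─ K.
minimal : 2 ≤ k → n ∸ r ≤ suc k → r < k + δ →
  Uniform r 𝒦 → K1 δ 𝒦 → K2 k 𝒦 → K3 𝒦 →
  ∀ S → S ⊂ ⊤ → (∃[ H ] restrict (kSetsNotInAny {n} k 𝒦) S H) →
  ∃[ H ] MeetsRestriction (kSetsNotInAny k 𝒦) S H
minimal 2≤k n∸r≤k+1 r<k+δ unif k1 k2 k3 S (_ , v , _ , v∉S) (H₀ , (∣H₀∣≡k , H₀-unc) , H₀⊆S)
  with k3 v
... | K , K∈𝒦 , v∉K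
  with extend (p─q⊆p S K) (s≤s⁻¹ (≤-trans (∣S─K∣<∣∁K∣ unif K∈𝒦 v v∉S v∉K) n∸r≤k+1))
              (subst (_≤ ∣ S ∣) ∣H₀∣≡k (p⊆q⇒∣p∣≤∣q∣ H₀⊆S))
... | H₁ , S─K⊆H₁ , H₁⊆S , ∣H₁∣≡k with nonempty? (H₁ ∩ K)
...   | no H₁∩K=∅ =
  H₁ , meets-restriction K∈𝒦 (∣H₁∣≡k , disjoint⇒uncovered unif k1 r<k+δ K∈𝒦 H₁∩K=∅ ∣H₁∣≡k)
                         H₁⊆S S─K⊆H₁
...   | yes (x , x∈H₁∩K) with x∈p∩q⁻ H₁ K x∈H₁∩K
...     | x∈H₁ , x∈K with exchange-lemma 2≤k k2 H₁⊆S ∣H₁∣≡k (uncovered-⊆ H₀-unc H₀⊆S) x∈H₁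
...       | H , H∈𝓗 , H⊆S , H₁-x⊆H = H , meets-restriction K∈𝒦 H∈𝓗 H⊆S S─K⊆H
  where
  S─K⊆H : S ─ K ⊆ H
  S─K⊆H z∈S─K = H₁-x⊆H (x∈p∧x≢y⇒x∈p-y (S─K⊆H₁ z∈S─K)
    (λ z≡x → x∈p─q⇒x∉q z∈S─K (subst (_∈ K) (sym z≡x) x∈K)))

-- The complement of a k-set has k + δ elements.
[2k+δ]∸k≡k+δ : ∀ k δ → 2 * k + δ ∸ k ≡ k + δ
[2k+δ]∸k≡k+δ k δ = trans (cong (_∸ k) (2k+δ≡k+[k+δ] k δ)) (m+n∸m≡n k (k + δ))
  where
  2k+δ≡k+[k+δ] : ∀ k δ → 2 * k + δ ≡ k + (k + δ)
  2k+δ≡k+[k+δ] = solve-∀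

-- The complement of a member of 𝒦 has k + 1 elements.
[2k+δ]∸r≡k+1 : ∀ k δ → 0 < δ → 2 * k + δ ∸ (k + δ ∸ 1) ≡ suc k
[2k+δ]∸r≡k+1 k (suc d) _ = begin
  2 * k + suc d ∸ (k + suc d ∸ 1) ≡⟨ cong₂ _∸_ (2k+d+1≡[k+d]+[k+1] k d) (cong (_∸ 1) (+-suc k d)) ⟩
  (k + d) + suc k ∸ (k + d)       ≡⟨ m+n∸m≡n (k + d) (suc k) ⟩
  suc k                           ∎
  where
  open ≡-Reasoning
  2k+d+1≡[k+d]+[k+1] : ∀ k d → 2 * k + suc d ≡ (k + d) + suc k
  2k+d+1≡[k+d]+[k+1] = solve-∀

2≤k-of-δ : ∀ k → 0 < δ → δ ≤ k ∸ 3 → 2 ≤ k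
2≤k-of-δ (suc (suc k)) _   _     = s≤s (s≤s z≤n)
2≤k-of-δ zero          0<δ δ≤k∸3 = contradiction δ≤k∸3 (<⇒≱ 0<δ)
2≤k-of-δ (suc zero)    0<δ δ≤k∸3 = contradiction δ≤k∸3 (<⇒≱ 0<δ)

lemma5p6 : (δ k : ℕ) → 0 < δ → δ ≤ k ∸ 3 →
    (𝒦 : List (Subset (2 * k + δ))) →
    Uniform (k + δ ∸ 1) 𝒦 → K1 δ 𝒦 → K2 k 𝒦 → K3 𝒦 →
    MinimalTransversalFree (kSetsNotInAny k 𝒦)
lemma5p6 δ k 0<δ δ≤k∸3 𝒦 unif k1 k2 k3 =
  transversal-free 2≤k (subst (k ≤_) (sym n∸k≡k+δ) (m≤m+n k δ))
                       (subst (k + δ ∸ 1 <_) (sym n∸k≡k+δ) r<k+δ) unif k2 ,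
  minimal 2≤k (≤-reflexive ([2k+δ]∸r≡k+1 k δ 0<δ)) r<k+δ unif k1 k2 k3
  where
  2≤k : 2 ≤ k
  2≤k = 2≤k-of-δ k 0<δ δ≤k∸3
  n∸k≡k+δ : 2 * k + δ ∸ k ≡ k + δ
  n∸k≡k+δ = [2k+δ]∸k≡k+δ k δ
  r<k+δ : k + δ ∸ 1 < k + δ
  r<k+δ = ∸-monoʳ-< (s≤s z≤n) (≤-trans 0<δ (m≤n+m δ k))
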